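{- Let $r \ge 1$ and let $k_1,\dots,k_r \ge 2$ be integers. Let $D(k_1,\dots,k_r)$ denote the difference Ramsey number and $S(k_1,\dots,k_r)$ the Issai number (defined in the context). Then $S(k_1,\dots,k_r) \le D(k_1,\dots,k_r) - 1$.
   Context: Difference graphs: for an integer $N\ge 1$, an $r$-coloring $\chi$ of the set $\{1,2,\dots,N-1\}$ induces an $r$-coloring of the edges of the complete graph $K_N$ on vertices $1,\dots,N$ by giving the edge $\{i,j\}$ ($i<j$) the color $\chi(j-i)$; such an edge-colored $K_N$ is called an ($r$-colored) difference graph. The difference Ramsey number $D(k_1,\dots,k_r)$ is the minimal integer $N$ such that every $r$-colored difference graph on $N$ vertices contains, for some $i \in \{1,\dots,r\}$, a complete subgraph on $k_i$ vertices all of whose edges have color $i$ (it exists since such $N$ is at most the classical Ramsey number $R(k_1,\dots,k_r)$). A Schur $k$-tuple is a $k$-tuple of positive integers $(x_1,\dots,x_k)$ (entries not necessarily distinct) with $x_1 + x_2 + \dots + x_{k-1} = x_k$. The Issai number $S(k_1,\dots,k_r)$ is the minimal integer $S$ such that every $r$-coloring of $\{1,2,\dots,S\}$ contains, for some $i \in \{1,\dots,r\}$, a Schur $k_i$-tuple all of whose entries lie in $\{1,\dots,S\}$ and have color $i$. -}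

module Defs where

open import Data.Nat using (ℕ; zero; suc; _+_; _≤_; _<_; _∸_)
open import Data.Fin using (Fin; inject₁; fromℕ) renaming (_<_ to _<ᶠ_)
open import Data.Product using (Σ; _×_; ∃-syntax)
open import Data.Empty using (⊥)
open import Relation.Binary.PropositionalEquality using (_≡_)

sumF : (m : ℕ) → (Fin m → ℕ) → ℕ
sumF zero    f = 0
sumF (suc m) f = f Fin.zero + sumF m (λ i → f (Fin.suc i))

-- A k-tuple (x_1,...,x_k) is given as x : Fin k → ℕ.
-- Schur k-tuple equation: x_1 + ... + x_{k-1} = x_k  (positivity imposed separately).
SchurEq : (k : ℕ) → (Fin k → ℕ) → Set
SchurEq zero    x = ⊥
SchurEq (suc m) x = sumF m (λ i → x (inject₁ i)) ≡ x (fromℕ m)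

-- r-colorings are functions ℕ → Fin r; only the values on the relevant
-- finite range ({1..N-1} resp. {1..S}) ever matter.
Coloring : ℕ → Set
Coloring r = ℕ → Fin r

HasMonoClique : {r : ℕ} → ℕ → Coloring r → Fin r → ℕ → Set
HasMonoClique N χ i k =
  Σ (Fin k → ℕ) λ v →
    (∀ a → 1 ≤ v a × v a ≤ N) ×
    (∀ a b → a <ᶠ b → v a < v b) ×
    (∀ a b → a <ᶠ b → χ (v b ∸ v a) ≡ i)

DiffRamseyProp : (r : ℕ) → (Fin r → ℕ) → ℕ → Set
DiffRamseyProp r ks N = (χ : Coloring r) → ∃[ i ] HasMonoClique N χ i (ks i)

IsDiffRamsey : (r : ℕ) → (Fin r → ℕ) → ℕ → Set
IsDiffRamsey r ks N =
  1 ≤ N × DiffRamseyProp r ks N × (∀ M → 1 ≤ M → DiffRamseyProp r ks M → N ≤ M)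

HasMonoSchur : {r : ℕ} → ℕ → Coloring r → Fin r → ℕ → Set
HasMonoSchur S χ i k =
  Σ (Fin k → ℕ) λ x →
    (∀ a → 1 ≤ x a × x a ≤ S) ×
    (∀ a → χ (x a) ≡ i) ×
    SchurEq k x

IssaiProp : (r : ℕ) → (Fin r → ℕ) → ℕ → Set
IssaiProp r ks S = (χ : Coloring r) → ∃[ i ] HasMonoSchur S χ i (ks i)

IsIssai : (r : ℕ) → (Fin r → ℕ) → ℕ → Set
IsIssai r ks S = IssaiProp r ks S × (∀ M → IssaiProp r ks M → S ≤ M)

-- If v₀ < v₁ < … < v_{k-1} is a colour-i clique in the difference graph on
-- {1,…,D}, then all differences v_b − v_a (a < b) have colour i and lie in
-- {1,…,D−1}; the k−1 consecutive gaps sum (telescopically) to v_{k-1} − v₀,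
-- so together with that difference they form a colour-i Schur k-tuple.
-- Hence the Issai property holds at D − 1, and since it is decidable (a
-- finite search over colourings and tuples), its least witness S exists.
module Submission where

open import Defs
open import Data.Nat using (ℕ; _≤_; _∸_)
open import Data.Fin using (Fin)
open import Data.Product using (_×_; ∃-syntax)

open import Data.Nat using (zero; suc; _+_; _<_; z≤n; s≤s)
open import Data.Nat.Properties
  using (<⇒≤; ≮⇒≥; m<n⇒0<n∸m; ∸-mono; m+n∸m≡n; m+[n∸m]≡n; +-assoc; +-identityʳ; _≟_; _≤?_; anyUpTo?)
open import Data.Nat.DivMod using (_mod_; m≤n⇒m%n≡m)
open import Data.Nat.Induction using (<-rec)
open import Data.Fin using (inject₁; fromℕ; fromℕ<; toℕ; punchIn; funToFin; finToFun)
  renaming (_<_ to _<ᶠ_)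
open import Data.Fin.Properties
  using (any?; all?; toℕ-fromℕ<; finToFun-funToFin; ≤̄⇒inject₁<)
  renaming (≤-refl to ≤ᶠ-refl; _≟_ to _≟ᶠ_)
open import Data.Vec.Functional using (Vector; insertAt)
open import Data.Vec.Functional.Properties using (insertAt-lookup; insertAt-punchIn)
open import Data.Product using (_,_; proj₁; proj₂; map₂)
open import Function using (_∘_)
open import Level using (0ℓ)
open import Relation.Nullary using (Dec; yes; no)
open import Relation.Nullary.Decidable using (map′; _×-dec_)
open import Relation.Unary using (Pred; Decidable)
open import Relation.Binary.PropositionalEquality
  using (_≡_; _≗_; refl; sym; trans; cong; cong₂; subst; module ≡-Reasoning)

sumF-cong : ∀ {m} {f g : Fin m → ℕ} → f ≗ g → sumF m f ≡ sumF m g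
sumF-cong {zero}  f≗g = refl
sumF-cong {suc m} f≗g = cong₂ _+_ (f≗g Fin.zero) (sumF-cong (f≗g ∘ Fin.suc))

sumF-telescope : ∀ m (v : Fin (suc m) → ℕ) → (∀ j → v (inject₁ j) ≤ v (Fin.suc j)) →
                 v Fin.zero + sumF m (λ j → v (Fin.suc j) ∸ v (inject₁ j)) ≡ v (fromℕ m)
sumF-telescope zero    v v-mono = +-identityʳ (v Fin.zero)
sumF-telescope (suc m) v v-mono = begin
  v₀ + ((v₁ ∸ v₀) + rest) ≡⟨ +-assoc v₀ (v₁ ∸ v₀) rest ⟨
  v₀ + (v₁ ∸ v₀) + rest   ≡⟨ cong (_+ rest) (m+[n∸m]≡n (v-mono Fin.zero)) ⟩
  v₁ + rest               ≡⟨ sumF-telescope m (v ∘ Fin.suc) (v-mono ∘ Fin.suc) ⟩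
  v (fromℕ (suc m))       ∎
  where
  open ≡-Reasoning
  v₀ v₁ rest : ℕ
  v₀ = v Fin.zero
  v₁ = v (Fin.suc Fin.zero)
  rest = sumF m (λ j → v (Fin.suc (Fin.suc j)) ∸ v (Fin.suc (inject₁ j)))

punchIn-fromℕ : ∀ {n} (j : Fin n) → punchIn (fromℕ n) j ≡ inject₁ j
punchIn-fromℕ Fin.zero    = refl
punchIn-fromℕ (Fin.suc j) = cong Fin.suc (punchIn-fromℕ j)

insertAt-fromℕ-inject₁ : ∀ {a n} {A : Set a} (xs : Vector A n) (x : A) (j : Fin n) →
                         insertAt xs (fromℕ n) x (inject₁ j) ≡ xs j
insertAt-fromℕ-inject₁ {n = n} xs x j =
  subst (λ i → insertAt xs (fromℕ n) x i ≡ xs j) (punchIn-fromℕ j) (insertAt-punchIn xs (fromℕ n) x j)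

insertAt-all : ∀ {a p n} {A : Set a} (P : Pred A p) {xs : Vector A n} {x : A} →
               (∀ j → P (xs j)) → P x → ∀ i j → P (insertAt xs i x j)
insertAt-all             P Pxs Px Fin.zero    Fin.zero    = Px
insertAt-all             P Pxs Px Fin.zero    (Fin.suc j) = Pxs j
insertAt-all {n = suc n} P Pxs Px (Fin.suc i) Fin.zero    = Pxs Fin.zero
insertAt-all {n = suc n} P Pxs Px (Fin.suc i) (Fin.suc j) = insertAt-all P (Pxs ∘ Fin.suc) Px i j

Least : ∀ {p} → Pred ℕ p → Pred ℕ p
Least P m = P m × ∀ k → P k → m ≤ k

least-witness : ∀ {p} {P : Pred ℕ p} → Decidable P → ∀ {n} → P n → ∃[ m ] Least P m
least-witness {P = P} P? {n} = <-rec (λ n → P n → ∃[ m ] Least P m) step n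
  where
  step : ∀ n → (∀ {k} → k < n → P k → ∃[ m ] Least P m) → P n → ∃[ m ] Least P m
  step n below Pn with anyUpTo? P? n
  ... | yes (k , k<n , Pk) = below k<n Pk
  ... | no nothing-below   = n , Pn , λ k Pk → ≮⇒≥ (λ k<n → nothing-below (k , k<n , Pk))

module _ {k S} {P : Pred (Fin k → ℕ) 0ℓ}
         (P-resp : ∀ {x y} → x ≗ y → P x → P y) (P? : Decidable P)
         (P-bounded : ∀ {x} → P x → ∀ a → x a ≤ S) where

  ∃-bounded? : Dec (∃[ x ] P x)
  ∃-bounded? = map′ (λ (c , p) → _ , p) encode (any? (λ c → P? (toℕ ∘ finToFun c)))
    where
    encode : ∃[ x ] P x → ∃[ c ] P (toℕ ∘ finToFun {suc S} {k} c)
    encode (x , p) = funToFin x̂ , P-resp (λ a → sym (decode a)) p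
      where
      x̂ : Fin k → Fin (suc S)
      x̂ a = fromℕ< (s≤s (P-bounded p a))
      decode : ∀ a → toℕ (finToFun (funToFin x̂) a) ≡ x a
      decode a = trans (cong toℕ (finToFun-funToFin x̂ a)) (toℕ-fromℕ< _)

module _ {r S} {Q : Pred (Coloring r) 0ℓ}
         (Q-local : ∀ {χ χ'} → (∀ {n} → n ≤ S → χ n ≡ χ' n) → Q χ → Q χ') (Q? : Decidable Q) where

  ∀-coloring? : Dec (∀ χ → Q χ)
  ∀-coloring? = map′ (λ h χ → Q-local (periodic-agrees χ) (h (funToFin (restrict χ)))) (λ h c → h _)
                     (all? (λ c → Q? (periodic (finToFun {r} {suc S} c))))
    where
    restrict : Coloring r → Fin (suc S) → Fin r
    restrict χ = χ ∘ toℕ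

    periodic : (Fin (suc S) → Fin r) → Coloring r
    periodic f n = f (n mod suc S)

    periodic-agrees : ∀ χ {n} → n ≤ S → periodic (finToFun (funToFin (restrict χ))) n ≡ χ n
    periodic-agrees χ {n} n≤S = trans (finToFun-funToFin (restrict χ) (n mod suc S))
                                      (cong χ (trans (toℕ-fromℕ< _) (m≤n⇒m%n≡m n≤S)))

SchurEq-resp : ∀ {k} {x y : Fin k → ℕ} → x ≗ y → SchurEq k x → SchurEq k y
SchurEq-resp {suc m} x≗y eq = trans (sym (sumF-cong (x≗y ∘ inject₁))) (trans eq (x≗y (fromℕ m)))

SchurEq? : ∀ k (x : Fin k → ℕ) → Dec (SchurEq k x)
SchurEq? zero    x = no λ ()
SchurEq? (suc m) x = sumF m (x ∘ inject₁) ≟ x (fromℕ m)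

module _ {r} (χ : Coloring r) (i : Fin r) where

  MonoEntry : ℕ → ℕ → Set
  MonoEntry S n = (1 ≤ n × n ≤ S) × χ n ≡ i

  HasMonoClique⇒HasMonoSchur : ∀ {N k} → 2 ≤ k → HasMonoClique N χ i k → HasMonoSchur (N ∸ 1) χ i k
  HasMonoClique⇒HasMonoSchur {N} {suc (suc m)} (s≤s (s≤s z≤n)) (v , v∈[1,N] , v-inc , v-col) =
    x , proj₁ ∘ x-good , proj₂ ∘ x-good , x-Schur
    where
    gap : Fin (suc m) → ℕ
    gap j = v (Fin.suc j) ∸ v (inject₁ j)

    inject₁<suc : ∀ (j : Fin (suc m)) → inject₁ j <ᶠ Fin.suc j
    inject₁<suc j = ≤̄⇒inject₁< ≤ᶠ-refl

    span : ℕ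
    span = v (fromℕ (suc m)) ∸ v Fin.zero

    x : Fin (suc (suc m)) → ℕ
    x = insertAt gap (fromℕ (suc m)) span

    difference-good : ∀ {a b} → a <ᶠ b → MonoEntry (N ∸ 1) (v b ∸ v a)
    difference-good {a} {b} a<b =
      (m<n⇒0<n∸m (v-inc a b a<b) , ∸-mono (proj₂ (v∈[1,N] b)) (proj₁ (v∈[1,N] a))) , v-col a b a<b

    x-good : ∀ a → MonoEntry (N ∸ 1) (x a)
    x-good = insertAt-all (MonoEntry (N ∸ 1))
      (λ j → difference-good (inject₁<suc j)) (difference-good (s≤s z≤n)) (fromℕ (suc m))

    x-Schur : SchurEq (suc (suc m)) x
    x-Schur = begin
      sumF (suc m) (x ∘ inject₁) ≡⟨ sumF-cong (insertAt-fromℕ-inject₁ gap span) ⟩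
      sumF (suc m) gap ≡⟨ m+n∸m≡n (v Fin.zero) (sumF (suc m) gap) ⟨
      v Fin.zero + sumF (suc m) gap ∸ v Fin.zero
        ≡⟨ cong (_∸ v Fin.zero) (sumF-telescope (suc m) v (λ j → <⇒≤ (v-inc _ _ (inject₁<suc j)))) ⟩
      span ≡⟨ sym (insertAt-lookup gap (fromℕ (suc m)) span) ⟩
      x (fromℕ (suc m)) ∎
      where open ≡-Reasoning

HasMonoSchur-local : ∀ {r S} {χ χ' : Coloring r} {i k} → (∀ {n} → n ≤ S → χ n ≡ χ' n) →
                     HasMonoSchur S χ i k → HasMonoSchur S χ' i k
HasMonoSchur-local χ≡χ' (x , x∈[1,S] , x-col , x-Schur) =
  x , x∈[1,S] , (λ a → trans (sym (χ≡χ' (proj₂ (x∈[1,S] a)))) (x-col a)) , x-Schur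

MonoSchurTuple : ∀ {r} → ℕ → Coloring r → Fin r → ∀ k → (Fin k → ℕ) → Set
MonoSchurTuple S χ i k x = (∀ a → 1 ≤ x a × x a ≤ S) × (∀ a → χ (x a) ≡ i) × SchurEq k x

MonoSchurTuple-resp : ∀ {r S} {χ : Coloring r} {i k} {x y : Fin k → ℕ} → x ≗ y →
                      MonoSchurTuple S χ i k x → MonoSchurTuple S χ i k y
MonoSchurTuple-resp {S = S} {χ} {i} x≗y (x∈[1,S] , x-col , x-Schur) =
  (λ a → subst (λ n → 1 ≤ n × n ≤ S) (x≗y a) (x∈[1,S] a)) ,
  (λ a → subst (λ n → χ n ≡ i) (x≗y a) (x-col a)) ,
  SchurEq-resp x≗y x-Schur

MonoSchurTuple? : ∀ {r} S (χ : Coloring r) i k → Decidable (MonoSchurTuple S χ i k)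
MonoSchurTuple? S χ i k x =
  all? (λ a → (1 ≤? x a) ×-dec (x a ≤? S)) ×-dec all? (λ a → χ (x a) ≟ᶠ i) ×-dec SchurEq? k x

HasMonoSchur? : ∀ {r} S (χ : Coloring r) i k → Dec (HasMonoSchur S χ i k)
HasMonoSchur? S χ i k =
  ∃-bounded? (MonoSchurTuple-resp {χ = χ}) (MonoSchurTuple? S χ i k) (λ (x∈[1,S] , _) a → proj₂ (x∈[1,S] a))

IssaiProp? : ∀ {r} (ks : Fin r → ℕ) S → Dec (IssaiProp r ks S)
IssaiProp? ks S = ∀-coloring? (λ χ≡χ' → map₂ (HasMonoSchur-local χ≡χ'))
                              (λ χ → any? (λ i → HasMonoSchur? S χ i (ks i)))

lemma2 : (r : ℕ) → 1 ≤ r → (ks : Fin r → ℕ) → (∀ i → 2 ≤ ks i) →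
         (D : ℕ) → IsDiffRamsey r ks D →
         ∃[ S ] (IsIssai r ks S × S ≤ D ∸ 1)
lemma2 r _ ks 2≤ks D (_ , D-ramsey , _) =
  let S , issai-S , S-least = least-witness (IssaiProp? ks) issai-D∸1
  in S , (issai-S , S-least) , S-least (D ∸ 1) issai-D∸1
  where
  issai-D∸1 : IssaiProp r ks (D ∸ 1)
  issai-D∸1 χ = let i , clique = D-ramsey χ
                in i , HasMonoClique⇒HasMonoSchur χ i (2≤ks i) clique
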